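{- Let $G=(V,E)$ be a finite undirected graph and let $T$ be a signed set over $E$, i.e. $T\subseteq\{+e\mid e\in E\}\cup\{ -e\mid e\in E\}$ such that for no $e\in E$ both $+e$ and $-e$ belong to $T$. Call an edge $e$ positive if $+e\in T$, negative if $-e\in T$, and zero otherwise. Then $T$ is a signed subgraph with minimal cutset (i.e. $T=S^{\pm}$ for some edge set $S\subseteq E$, where $S^{\pm}$ is defined below) if and only if both of the following hold: (1) for every vertex $v\in V$, it is not the case that both a zero edge and a positive edge are incident to $v$; (2) for every negative edge $\{u,v\}$, a positive edge is incident to at least one of $u$ and $v$.
   Context: For $S\subseteq E$, let $\mathrm{dom}(S)$ be the set of vertices that are endpoints of at least one edge of $S$, and define the signed set $S^{\pm}=S^{+}\cup S^{ - }$ where $S^{+}=\{+e\mid e\in S\}$ and $S^{ - }=\{ -e\mid e\in E\setminus S,\ e\cap\mathrm{dom}(S)\neq\emptyset\}$. A signed set of the form $S^{\pm}$ for some $S\subseteq E$ is called a signed subgraph with minimal cutset. -}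

module Defs where

open import Data.Nat using (ℕ)
open import Data.Fin using (Fin)
open import Data.Fin.Subset using (Subset; _∈_; _∉_)
open import Data.Product using (Σ; ∃; _×_; proj₁; proj₂; _,_)
open import Data.Sum using (_⊎_)
open import Relation.Binary.PropositionalEquality using (_≡_; _≢_)
open import Relation.Nullary using (¬_)
open import Function.Bundles using (_⇔_)

record Graph : Set where
  field
    n : ℕ
    m : ℕ
    endA endB : Fin m → Fin n
    loopless : ∀ e → endA e ≢ endB e
    simple : ∀ e f → ((endA e ≡ endA f × endB e ≡ endB f) ⊎ (endA e ≡ endB f × endB e ≡ endA f)) → e ≡ f

module _ (G : Graph) where
  open Graph G

  Vertex : Set
  Vertex = Fin n

  Edge : Set
  Edge = Fin m

  Incident : Vertex → Edge → Set
  Incident v e = v ≡ endA e ⊎ v ≡ endB e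

  -- A signed set over E: the set of edges e with +e ∈ T and the set of
  -- edges e with -e ∈ T, with no e having both.
  record SignedSet : Set where
    field
      plus  : Subset m
      minus : Subset m
      disjoint : ∀ e → ¬ (e ∈ plus × e ∈ minus)

  dom : Subset m → Vertex → Set
  dom S v = ∃ λ e → e ∈ S × Incident v e

  meetsDom : Subset m → Edge → Set
  meetsDom S e = ∃ λ v → Incident v e × dom S v

  -- T = S^±  (S^+ = {+e | e ∈ S}, S^- = {-e | e ∉ S, e ∩ dom(S) ≠ ∅})
  IsSPM : SignedSet → Subset m → Set
  IsSPM T S = ∀ e → (e ∈ SignedSet.plus T ⇔ e ∈ S)
                  × (e ∈ SignedSet.minus T ⇔ (e ∉ S × meetsDom S e))

  SignedSubgraphMinCut : SignedSet → Set
  SignedSubgraphMinCut T = ∃ λ S → IsSPM T S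

  Positive Negative Zero : SignedSet → Edge → Set
  Positive T e = e ∈ SignedSet.plus T
  Negative T e = e ∈ SignedSet.minus T
  Zero T e = e ∉ SignedSet.plus T × e ∉ SignedSet.minus T

  Cond1 : SignedSet → Set
  Cond1 T = ∀ v → ¬ ((∃ λ e → Zero T e × Incident v e) × (∃ λ f → Positive T f × Incident v f))

  Cond2 : SignedSet → Set
  Cond2 T = ∀ e → Negative T e →
    (∃ λ f → Positive T f × Incident (endA e) f) ⊎ (∃ λ f → Positive T f × Incident (endB e) f)

module Submission where

-- The key observation is that the witness is forced: if T = S^± then
-- +e ∈ T exactly when e ∈ S, so S is the set of positive edges of T and
-- dom(S) is the set of vertices touched by a positive edge.  Hence
-- T is of the form S^± iff T = P^± for P = plus T, i.e. iff every edge
-- satisfies:  e is negative  ⇔  e is not positive and e meets dom(P).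
-- Splitting this equivalence into its two directions gives the two
-- conditions of the theorem:
--   ⇒ (negative edges meet dom(P))   is Cond2, since an edge meets a
--                                    vertex set iff one endpoint lies in it;
--   ⇐ (non-positive edges meeting dom(P) are negative) is Cond1, read as
--     "no zero edge meets dom(P)"; the positive case is excluded by
--     disjointness of T, and negativity is recovered by decidability.

open import Defs
open import Data.Fin.Subset using (Subset; _∈_; _∉_)
open import Data.Fin.Subset.Properties using (_∈?_)
open import Data.Product using (_×_; _,_; proj₁; proj₂)
open import Data.Sum using (_⊎_; inj₁; inj₂)
open import Function.Bundles using (_⇔_; mk⇔; Equivalence)
open import Relation.Binary.PropositionalEquality using (refl)
open import Relation.Nullary using (¬_)
open import Relation.Nullary.Decidable using (decidable-stable)

open Equivalence

module _ (G : Graph) where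
  open Graph G

  dom-mono : ∀ {S S′ : Subset m} → (∀ e → e ∈ S → e ∈ S′) →
             ∀ v → dom G S v → dom G S′ v
  dom-mono S⊆S′ v (f , f∈S , v∼f) = f , S⊆S′ f f∈S , v∼f

  meetsDom-mono : ∀ {S S′ : Subset m} → (∀ e → e ∈ S → e ∈ S′) →
                  ∀ e → meetsDom G S e → meetsDom G S′ e
  meetsDom-mono S⊆S′ e (v , v∼e , v∈dom) = v , v∼e , dom-mono S⊆S′ v v∈dom

  meetsDom⇔endpoint : ∀ S e →
    meetsDom G S e ⇔ (dom G S (endA e) ⊎ dom G S (endB e))
  meetsDom⇔endpoint S e = mk⇔ toEndpoint fromEndpoint
    where
    toEndpoint : meetsDom G S e → dom G S (endA e) ⊎ dom G S (endB e)
    toEndpoint (_ , inj₁ refl , a∈dom) = inj₁ a∈dom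
    toEndpoint (_ , inj₂ refl , b∈dom) = inj₂ b∈dom
    fromEndpoint : dom G S (endA e) ⊎ dom G S (endB e) → meetsDom G S e
    fromEndpoint (inj₁ a∈dom) = endA e , inj₁ refl , a∈dom
    fromEndpoint (inj₂ b∈dom) = endB e , inj₂ refl , b∈dom

module _ (G : Graph) (T : SignedSet G) where
  open SignedSet T

  cond2⇔negativeMeetsDom :
    Cond2 G T ⇔ (∀ e → Negative G T e → meetsDom G plus e)
  cond2⇔negativeMeetsDom = mk⇔
    (λ c2 e e⁻ → from (meetsDom⇔endpoint G plus e) (c2 e e⁻))
    (λ meets e e⁻ → to (meetsDom⇔endpoint G plus e) (meets e e⁻))

  cond1⇔zeroAvoidsDom :
    Cond1 G T ⇔ (∀ e → Zero G T e → ¬ meetsDom G plus e)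
  cond1⇔zeroAvoidsDom = mk⇔
    (λ c1 e e⁰ (v , v∼e , v∈dom) → c1 v ((e , e⁰ , v∼e) , v∈dom))
    (λ avoids v ((e , e⁰ , v∼e) , v∈dom) → avoids e e⁰ (v , v∼e , v∈dom))

  -- The witness of T = S^± is forced to be P: the plus-part of T is S,
  -- so S may be replaced by P throughout.
  spm⇒spmPlus : ∀ S → IsSPM G T S → IsSPM G T plus
  spm⇒spmPlus S iso e =
      mk⇔ (λ e⁺ → e⁺) (λ e⁺ → e⁺)
    , mk⇔ (λ e⁻ → let (e∉S , meetsS) = to (minus⇔ e) e⁻
                  in (λ e⁺ → e∉S (to (plus⇔ e) e⁺)) , meetsDom-mono G S⊆P e meetsS)
          (λ (e∉P , meetsP) → from (minus⇔ e)
                  ((λ e∈S → e∉P (from (plus⇔ e) e∈S)) , meetsDom-mono G P⊆S e meetsP))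
    where
    plus⇔ : ∀ f → (f ∈ plus ⇔ f ∈ S)
    plus⇔ f = proj₁ (iso f)
    minus⇔ : ∀ f → (f ∈ minus ⇔ (f ∉ S × meetsDom G S f))
    minus⇔ f = proj₂ (iso f)
    S⊆P : ∀ f → f ∈ S → f ∈ plus
    S⊆P f = from (plus⇔ f)
    P⊆S : ∀ f → f ∈ plus → f ∈ S
    P⊆S f = to (plus⇔ f)

  spmPlus⇔conditions : IsSPM G T plus ⇔ (Cond1 G T × Cond2 G T)
  spmPlus⇔conditions = mk⇔ conditions spmPlus
    where
    conditions : IsSPM G T plus → Cond1 G T × Cond2 G T
    conditions iso =
        from cond1⇔zeroAvoidsDom
          (λ e (e∉P , e∉N) meets → e∉N (from (proj₂ (iso e)) (e∉P , meets)))
      , from cond2⇔negativeMeetsDom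
          (λ e e⁻ → proj₂ (to (proj₂ (iso e)) e⁻))

    -- A non-positive edge meeting dom(P) is not zero, hence negative.
    spmPlus : Cond1 G T × Cond2 G T → IsSPM G T plus
    spmPlus (c1 , c2) e =
        mk⇔ (λ e⁺ → e⁺) (λ e⁺ → e⁺)
      , mk⇔ (λ e⁻ → (λ e⁺ → disjoint e (e⁺ , e⁻)) , to cond2⇔negativeMeetsDom c2 e e⁻)
            (λ (e∉P , meets) → decidable-stable (e ∈? minus)
               (λ e∉N → to cond1⇔zeroAvoidsDom c1 e (e∉P , e∉N) meets))

mainTheorem2 : (G : Graph) → (T : SignedSet G) →
    SignedSubgraphMinCut G T ⇔ (Cond1 G T × Cond2 G T)
mainTheorem2 G T = mk⇔
  (λ (S , iso) → to (spmPlus⇔conditions G T) (spm⇒spmPlus G T S iso))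
  (λ conds → SignedSet.plus T , from (spmPlus⇔conditions G T) conds)
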